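{- Consider an instance of the constructive \$-protection problem (all voter weights equal to $1$). Suppose the defender succeeds by awarding a set $\mathcal V_F\subseteq\mathcal V$ with $\sum_{v_j\in\mathcal V_F}p^a_j\le F$. If $v_{j'}\prec v_j$, $v_{j'}\in\mathcal V_F$ and $v_j\notin\mathcal V_F$, then the defender also succeeds by awarding $(\mathcal V_F\setminus\{v_{j'}\})\cup\{v_j\}$.
   Context: An election has candidates $c_1,\dots,c_m$ and voters $\mathcal V=\{v_1,\dots,v_n\}$, each of weight $1$; voter $v_j$ has a preference list $\tau_j$, awarding price $p^a_j$ and bribing price $p^b_j$. Under a scoring rule $\alpha_1\ge\dots\ge\alpha_m$ (nonnegative integers), each voter gives $\alpha_z$ points to the candidate in position $z$ of its list. There is a designated candidate $d$. The defender with budget $F$ awards $\mathcal V_F$ (total awarding price $\le F$); the attacker with budget $B$ bribes $\mathcal V_B\subseteq\mathcal V\setminus\mathcal V_F$ with total bribing price $\le B$ and replaces their lists arbitrarily. The defender succeeds with $\mathcal V_F$ if for every such $\mathcal V_B$ and new lists, $d$ does not get a score strictly higher than every other candidate. Dominance: $v_{j'}\prec v_j$ if either (i) $\tau_j=\tau_{j'}$, $w_j\ge w_{j'}$, $p^a_j\le p^a_{j'}$, $p^b_j\le p^b_{j'}$ with at least one strict inequality; or (ii) $\tau_j=\tau_{j'}$, $w_j=w_{j'}$, $p^a_j=p^a_{j'}$, $p^b_j=p^b_{j'}$ and $j'<j$ (here all $w_j=1$). -}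

module Defs where

open import Data.Nat using (ℕ; _≤_; _<_)
open import Data.Bool using (Bool; true; false; if_then_else_)
open import Data.Fin using (Fin; _≟_)
open import Data.Fin.Subset using (Subset; _∈_; _∉_; _-_; _∪_; ⁅_⁆)
open import Data.Vec using (Vec; lookup)
open import Data.List using (List; map; allFin)
open import Data.Nat.ListAction using (sum)
open import Data.Product using (_×_)
open import Data.Sum using (_⊎_)
open import Relation.Nullary using (¬_; does)
open import Relation.Binary.PropositionalEquality using (_≡_; _≢_)
open import Function.Definitions using (Injective)

sumFin : (n : ℕ) → (Fin n → ℕ) → ℕ
sumFin n f = sum (map f (allFin n))

-- A preference list over m candidates: position z ↦ candidate at position z.
Ballot : ℕ → Set
Ballot m = Vec (Fin m) m

IsPrefList : {m : ℕ} → Ballot m → Set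
IsPrefList {m} τ = Injective _≡_ _≡_ (lookup τ)

Antitone : {m : ℕ} → (Fin m → ℕ) → Set
Antitone {m} α = ∀ (z z' : Fin m) → Data.Fin._≤_ z z' → α z' ≤ α z

points : {m : ℕ} → (Fin m → ℕ) → Ballot m → Fin m → ℕ
points {m} α τ c = sumFin m (λ z → if does (lookup τ z ≟ c) then α z else 0)

score : {m n : ℕ} → (Fin m → ℕ) → (Fin n → Ballot m) → Fin m → ℕ
score {m} {n} α P c = sumFin n (λ j → points α (P j) c)

cost : {n : ℕ} → (Fin n → ℕ) → Subset n → ℕ
cost {n} p S = sumFin n (λ j → if lookup S j then p j else 0)

UniqueWinner : {m n : ℕ} → (Fin m → ℕ) → (Fin n → Ballot m) → Fin m → Set
UniqueWinner α P d = ∀ c → c ≢ d → score α P c < score α P d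

bribed : {m n : ℕ} → (Fin n → Ballot m) → Subset n → (Fin n → Ballot m) → Fin n → Ballot m
bribed τ VB σ j = if lookup VB j then σ j else τ j

DefenderSucceeds : {m n : ℕ} → (α : Fin m → ℕ) → (τ : Fin n → Ballot m) →
                   (pb : Fin n → ℕ) → (d : Fin m) → (B : ℕ) → Subset n → Set
DefenderSucceeds {m} {n} α τ pb d B VF =
  ∀ (VB : Subset n) (σ : Fin n → Ballot m) →
    (∀ j → j ∈ VB → j ∉ VF) →
    cost pb VB ≤ B →
    (∀ j → j ∈ VB → IsPrefList (σ j)) →
    ¬ UniqueWinner α (bribed τ VB σ) d

-- Dominance v_{j'} ≺ v_j (all weights equal to 1, so the weight comparison is trivial).
Dominated : {m n : ℕ} → (τ : Fin n → Ballot m) → (pa pb : Fin n → ℕ) → Fin n → Fin n → Set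
Dominated τ pa pb j' j =
  (τ j ≡ τ j' × pa j ≤ pa j' × pb j ≤ pb j' × (pa j < pa j' ⊎ pb j < pb j'))
  ⊎ (τ j ≡ τ j' × pa j ≡ pa j' × pb j ≡ pb j' × Data.Fin._<_ j' j)

exchange : {n : ℕ} → Subset n → Fin n → Fin n → Subset n
exchange VF j' j = (VF - j') ∪ ⁅ j ⁆

-- Exchanging j' for j is relabelling the voters by the transposition π = (j' j). It maps VF
-- onto the exchanged set and fixes the profile since τ j ≡ τ j'; since j dominates j', it
-- does not raise the awarding price of VF nor the bribing price of any attack avoiding the
-- exchanged set. Scores are sums over voters, hence invariant under relabelling, so every
-- attack on the exchanged set is the relabelling of an attack on VF that costs no more and
-- produces the same scores.
module Submission where

open import Defs
open import Data.Nat using (ℕ; _≤_)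
open import Data.Fin using (Fin)
open import Data.Fin.Subset using (Subset; _∈_; _∉_)
open import Data.Product using (_×_)

open import Data.Nat using (zero; suc; _+_; _<_; z≤n)
open import Data.Nat.Properties
  using (+-mono-≤; ≤-refl; ≤-reflexive; ≤-trans; +-0-commutativeMonoid)
open import Data.Nat.ListAction using (sum)
open import Data.Fin using (zero; suc; _≟_)
open import Data.Fin.Subset using (⁅_⁆; _─_)
open import Data.Fin.Permutation using (Permutation′; _⟨$⟩ʳ_; _⟨$⟩ˡ_; inverseˡ; flip; transpose)
import Data.Fin.Permutation.Components as PC
open import Data.Bool using (true; false; if_then_else_; _∧_; _∨_; not)
open import Data.Bool.Properties using (∧-identityʳ; ∧-zeroʳ; ∨-identityʳ; ∨-zeroʳ)
open import Data.Vec using (lookup; _∷_)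
import Data.Vec as Vec
open import Data.Vec.Properties
  using ([]=⇒lookup; lookup⇒[]=; lookup∘tabulate; lookup-zipWith; lookup-replicate;
         tabulate∘lookup; tabulate-cong)
open import Data.List using (map; tabulate; allFin)
open import Data.List.Properties using (map-cong; map-tabulate)
open import Data.Product using (_,_)
open import Data.Sum using (inj₁; inj₂)
open import Function using (_∘_; id)
open import Relation.Nullary using (does; yes; no; contradiction)
open import Relation.Nullary.Decidable using (dec-true; dec-false)
open import Relation.Binary.PropositionalEquality
open import Algebra.Properties.CommutativeMonoid.Sum +-0-commutativeMonoid
  using (sum-permute) renaming (sum to ∑)

sumFin≡∑ : ∀ {n} (f : Fin n → ℕ) → sumFin n f ≡ ∑ f
sumFin≡∑ {zero}  f = refl
sumFin≡∑ {suc n} f = cong (f zero +_) (begin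
  sum (map f (tabulate suc)) ≡⟨ cong sum (map-tabulate suc f) ⟩
  sum (tabulate (f ∘ suc))   ≡⟨ cong sum (map-tabulate id (f ∘ suc)) ⟨
  sumFin n (f ∘ suc)         ≡⟨ sumFin≡∑ (f ∘ suc) ⟩
  ∑ (f ∘ suc)                ∎)
  where open ≡-Reasoning

sumFin-cong : ∀ {n} {f g : Fin n → ℕ} → (∀ k → f k ≡ g k) → sumFin n f ≡ sumFin n g
sumFin-cong {n} f≗g = cong sum (map-cong f≗g (allFin n))

sumFin-mono-≤ : ∀ {n} {f g : Fin n → ℕ} → (∀ k → f k ≤ g k) → sumFin n f ≤ sumFin n g
sumFin-mono-≤ {f = f} {g} f≤g = subst₂ _≤_ (sym (sumFin≡∑ f)) (sym (sumFin≡∑ g)) (∑-mono-≤ f≤g)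
  where
  ∑-mono-≤ : ∀ {n} {f g : Fin n → ℕ} → (∀ k → f k ≤ g k) → ∑ f ≤ ∑ g
  ∑-mono-≤ {zero}  _   = z≤n
  ∑-mono-≤ {suc n} f≤g = +-mono-≤ (f≤g zero) (∑-mono-≤ (f≤g ∘ suc))

sumFin-permute : ∀ {n} (f : Fin n → ℕ) (π : Permutation′ n) →
                 sumFin n (f ∘ (π ⟨$⟩ʳ_)) ≡ sumFin n f
sumFin-permute {n} f π = begin
  sumFin n (f ∘ (π ⟨$⟩ʳ_)) ≡⟨ sumFin≡∑ (f ∘ (π ⟨$⟩ʳ_)) ⟩
  ∑ (f ∘ (π ⟨$⟩ʳ_))        ≡⟨ sum-permute f π ⟨
  ∑ f                      ≡⟨ sumFin≡∑ f ⟨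
  sumFin n f               ∎
  where open ≡-Reasoning

module _ {n : ℕ} (i j : Fin n) where

  transpose-matchˡ : PC.transpose i j i ≡ j
  transpose-matchˡ rewrite dec-true (i ≟ i) refl = refl

  transpose-sym : ∀ k → PC.transpose i j k ≡ PC.transpose j i k
  transpose-sym k with k ≟ i | k ≟ j
  ... | yes refl | yes refl = refl
  ... | yes refl | no _     rewrite dec-true (k ≟ k) refl = refl
  ... | no _     | yes refl rewrite dec-true (k ≟ k) refl = refl
  ... | no k≢i   | no k≢j   rewrite dec-false (k ≟ i) k≢i | dec-false (k ≟ j) k≢j = refl

  transpose-invariant : ∀ {a} {A : Set a} (f : Fin n → A) → f i ≡ f j →
                        ∀ k → f (PC.transpose i j k) ≡ f k
  transpose-invariant f fi≡fj k with k ≟ i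
  ... | yes refl = sym fi≡fj
  ... | no _ with k ≟ j
  ...   | yes refl = fi≡fj
  ...   | no _     = refl

  transpose-≤ : (p : Fin n → ℕ) → p j ≤ p i → ∀ k → k ≢ j → p (PC.transpose i j k) ≤ p k
  transpose-≤ p pj≤pi k k≢j with k ≟ i
  ... | yes refl = pj≤pi
  ... | no _ with k ≟ j
  ...   | yes k≡j = contradiction k≡j k≢j
  ...   | no _    = ≤-refl

∉⇒lookup≡false : ∀ {n} {S : Subset n} {k : Fin n} → k ∉ S → lookup S k ≡ false
∉⇒lookup≡false {S = S} {k} k∉S with lookup S k in eq
... | true  = contradiction (lookup⇒[]= k S eq) k∉S
... | false = refl

lookup-⁅⁆ : ∀ {n} (i k : Fin n) → lookup ⁅ i ⁆ k ≡ does (k ≟ i)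
lookup-⁅⁆ zero    zero    = refl
lookup-⁅⁆ zero    (suc k) = lookup-replicate k false
lookup-⁅⁆ (suc i) zero    = refl
lookup-⁅⁆ (suc i) (suc k) = lookup-⁅⁆ i k

lookup-─ : ∀ {n} (p q : Subset n) k → lookup (p ─ q) k ≡ lookup p k ∧ not (lookup q k)
lookup-─ (b ∷ _) (true  ∷ _) zero    = sym (∧-zeroʳ b)
lookup-─ (b ∷ _) (false ∷ _) zero    = sym (∧-identityʳ b)
lookup-─ (_ ∷ p) (_ ∷ q)     (suc k) = lookup-─ p q k

lookup-exchange : ∀ {n} (S : Subset n) (i j k : Fin n) →
                  lookup (exchange S i j) k ≡ (lookup S k ∧ not (does (k ≟ i))) ∨ does (k ≟ j)
lookup-exchange S i j k = begin
  lookup (exchange S i j) k                          ≡⟨ lookup-zipWith _∨_ k (S ─ ⁅ i ⁆) ⁅ j ⁆ ⟩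
  lookup (S ─ ⁅ i ⁆) k ∨ lookup ⁅ j ⁆ k              ≡⟨ cong₂ _∨_ (lookup-─ S ⁅ i ⁆ k) (lookup-⁅⁆ j k) ⟩
  (lookup S k ∧ not (lookup ⁅ i ⁆ k)) ∨ does (k ≟ j) ≡⟨ cong (λ b → (lookup S k ∧ not b) ∨ does (k ≟ j)) (lookup-⁅⁆ i k) ⟩
  (lookup S k ∧ not (does (k ≟ i))) ∨ does (k ≟ j)   ∎
  where open ≡-Reasoning

image : ∀ {n} → Permutation′ n → Subset n → Subset n
image π S = Vec.tabulate (lookup S ∘ (π ⟨$⟩ˡ_))

module _ {n : ℕ} (π : Permutation′ n) (S : Subset n) where

  lookup-image : ∀ k → lookup (image π S) k ≡ lookup S (π ⟨$⟩ˡ k)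
  lookup-image = lookup∘tabulate (lookup S ∘ (π ⟨$⟩ˡ_))

  lookup-image-⟨$⟩ʳ : ∀ x → lookup (image π S) (π ⟨$⟩ʳ x) ≡ lookup S x
  lookup-image-⟨$⟩ʳ x = trans (lookup-image (π ⟨$⟩ʳ x)) (cong (lookup S) (inverseˡ π))

  ∈-image⁺ : ∀ {x} → x ∈ S → π ⟨$⟩ʳ x ∈ image π S
  ∈-image⁺ {x} x∈S = lookup⇒[]= _ (image π S) (trans (lookup-image-⟨$⟩ʳ x) ([]=⇒lookup x∈S))

  ∈-image⁻ : ∀ {k} → k ∈ image π S → π ⟨$⟩ˡ k ∈ S
  ∈-image⁻ {k} k∈πS = lookup⇒[]= _ S (trans (sym (lookup-image k)) ([]=⇒lookup k∈πS))

  cost-image : ∀ p → cost p (image π S) ≡ cost (p ∘ (π ⟨$⟩ʳ_)) S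
  cost-image p = trans (sym (sumFin-permute priced π)) (sumFin-cong (λ x →
      cong (λ b → if b then p (π ⟨$⟩ʳ x) else 0) (lookup-image-⟨$⟩ʳ x)))
    where
    priced : Fin n → ℕ
    priced k = if lookup (image π S) k then p k else 0

cost-mono-≤ : ∀ {n} {p q : Fin n → ℕ} (S : Subset n) → (∀ k → k ∈ S → p k ≤ q k) →
              cost p S ≤ cost q S
cost-mono-≤ {p = p} {q} S p≤q = sumFin-mono-≤ priced-≤
  where
  priced-≤ : ∀ k → (if lookup S k then p k else 0) ≤ (if lookup S k then q k else 0)
  priced-≤ k with lookup S k in eq
  ... | true  = p≤q k (lookup⇒[]= k S eq)
  ... | false = z≤n

cost-image-≤ : ∀ {n} (p : Fin n → ℕ) (π : Permutation′ n) (S : Subset n) →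
               (∀ k → k ∈ S → p (π ⟨$⟩ʳ k) ≤ p k) → cost p (image π S) ≤ cost p S
cost-image-≤ p π S cheaper = ≤-trans (≤-reflexive (cost-image π S p)) (cost-mono-≤ S cheaper)

exchange≡image-transpose : ∀ {n} {S : Subset n} {i j : Fin n} → i ∈ S → j ∉ S →
                           exchange S i j ≡ image (transpose i j) S
exchange≡image-transpose {S = S} {i} {j} i∈S j∉S =
  trans (sym (tabulate∘lookup (exchange S i j))) (tabulate-cong swapped)
  where
  swapped : ∀ k → lookup (exchange S i j) k ≡ lookup S (PC.transpose j i k)
  swapped k rewrite lookup-exchange S i j k with k ≟ j
  ... | yes refl = trans (∨-zeroʳ _) (sym ([]=⇒lookup i∈S))
  ... | no _ with k ≟ i
  ...   | yes refl = trans (∨-identityʳ _) (trans (∧-zeroʳ _) (sym (∉⇒lookup≡false j∉S)))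
  ...   | no _     = trans (∨-identityʳ _) (∧-identityʳ _)

module _ {m n : ℕ} (α : Fin m → ℕ) where

  score-cong : ∀ {P Q : Fin n → Ballot m} → (∀ k → P k ≡ Q k) → ∀ c → score α P c ≡ score α Q c
  score-cong P≗Q c = sumFin-cong (λ k → cong (λ b → points α b c) (P≗Q k))

  score-permute : ∀ (P : Fin n → Ballot m) (π : Permutation′ n) c →
                  score α (P ∘ (π ⟨$⟩ʳ_)) c ≡ score α P c
  score-permute P π c = sumFin-permute (λ k → points α (P k) c) π

  UniqueWinner-resp : ∀ (P Q : Fin n → Ballot m) {d} → (∀ c → score α P c ≡ score α Q c) →
                      UniqueWinner α P d → UniqueWinner α Q d
  UniqueWinner-resp P Q {d} P≈Q win c c≢d = subst₂ _<_ (P≈Q c) (P≈Q d) (win c c≢d)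

bribed-image : ∀ {m n} {τ : Fin n → Ballot m} (π : Permutation′ n) → (∀ k → τ (π ⟨$⟩ʳ k) ≡ τ k) →
               ∀ VB σ k → bribed τ (image (flip π) VB) (σ ∘ (π ⟨$⟩ʳ_)) k ≡ bribed τ VB σ (π ⟨$⟩ʳ k)
bribed-image π τ∘π≗τ VB σ k rewrite lookup-image (flip π) VB k with lookup VB (π ⟨$⟩ʳ k)
... | true  = refl
... | false = sym (τ∘π≗τ k)

DefenderSucceeds-image : ∀ {m n} {α : Fin m → ℕ} {τ : Fin n → Ballot m} {pb d B VF}
  (π : Permutation′ n) → (∀ k → τ (π ⟨$⟩ʳ k) ≡ τ k) →
  (∀ k → k ∉ image π VF → pb (π ⟨$⟩ˡ k) ≤ pb k) →
  DefenderSucceeds α τ pb d B VF → DefenderSucceeds α τ pb d B (image π VF)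
DefenderSucceeds-image {α = α} {τ} {pb} {VF = VF} π τ∘π≗τ cheaper succeeds
    VB σ disjoint costB valid win =
  succeeds VB' σ' disjoint' (≤-trans costB' costB) (λ k → valid _ ∘ ∈-image⁻ (flip π) VB)
    (UniqueWinner-resp α (bribed τ VB σ) (bribed τ VB' σ') sameScores win)
  where
  VB' = image (flip π) VB
  σ' = σ ∘ (π ⟨$⟩ʳ_)
  disjoint' : ∀ k → k ∈ VB' → k ∉ VF
  disjoint' k k∈VB' k∈VF = disjoint _ (∈-image⁻ (flip π) VB k∈VB') (∈-image⁺ π VF k∈VF)
  costB' : cost pb VB' ≤ cost pb VB
  costB' = cost-image-≤ pb (flip π) VB (λ k k∈VB → cheaper k (disjoint k k∈VB))
  sameScores : ∀ c → score α (bribed τ VB σ) c ≡ score α (bribed τ VB' σ') c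
  sameScores c = sym (trans (score-cong α (bribed-image π τ∘π≗τ VB σ) c)
                            (score-permute α (bribed τ VB σ) π c))

module _ {m n : ℕ} {τ : Fin n → Ballot m} {pa pb : Fin n → ℕ} {j' j : Fin n} where

  dominated⇒≡ballot : Dominated τ pa pb j' j → τ j ≡ τ j'
  dominated⇒≡ballot (inj₁ (τ≡ , _)) = τ≡
  dominated⇒≡ballot (inj₂ (τ≡ , _)) = τ≡

  dominated⇒≤award : Dominated τ pa pb j' j → pa j ≤ pa j'
  dominated⇒≤award (inj₁ (_ , pa≤ , _)) = pa≤
  dominated⇒≤award (inj₂ (_ , pa≡ , _)) = ≤-reflexive pa≡

  dominated⇒≤bribe : Dominated τ pa pb j' j → pb j ≤ pb j'
  dominated⇒≤bribe (inj₁ (_ , _ , pb≤ , _)) = pb≤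
  dominated⇒≤bribe (inj₂ (_ , _ , pb≡ , _)) = ≤-reflexive pb≡

lemma8 : ∀ {m n : ℕ} (α : Fin m → ℕ) → Antitone α →
    (τ : Fin n → Ballot m) → (∀ j → IsPrefList (τ j)) →
    (pa pb : Fin n → ℕ) (d : Fin m) (F B : ℕ) (VF : Subset n) →
    cost pa VF ≤ F →
    DefenderSucceeds α τ pb d B VF →
    (j' j : Fin n) → Dominated τ pa pb j' j → j' ∈ VF → j ∉ VF →
    cost pa (exchange VF j' j) ≤ F × DefenderSucceeds α τ pb d B (exchange VF j' j)
lemma8 α _ τ _ pa pb d F B VF costF succeeds j' j j'≺j j'∈VF j∉VF
  rewrite exchange≡image-transpose j'∈VF j∉VF =
    ≤-trans awardCost costF , DefenderSucceeds-image π sameBallots cheaper succeeds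
  where
  π = transpose j' j
  awardCost : cost pa (image π VF) ≤ cost pa VF
  awardCost = cost-image-≤ pa π VF λ k k∈VF →
    transpose-≤ j' j pa (dominated⇒≤award j'≺j) k λ { refl → j∉VF k∈VF }
  sameBallots : ∀ k → τ (PC.transpose j' j k) ≡ τ k
  sameBallots = transpose-invariant j' j τ (sym (dominated⇒≡ballot j'≺j))
  j∈image : j ∈ image π VF
  j∈image = subst (_∈ image π VF) (transpose-matchˡ j' j) (∈-image⁺ π VF j'∈VF)
  cheaper : ∀ k → k ∉ image π VF → pb (PC.transpose j j' k) ≤ pb k
  cheaper k k∉image = subst (λ x → pb x ≤ pb k) (transpose-sym j' j k)
    (transpose-≤ j' j pb (dominated⇒≤bribe j'≺j) k λ { refl → k∉image j∈image })
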